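{- Let $v\ge4$. As formal power series in $y$, \[1+\sum_{d=1}^\infty \sum_{D \in \mathcal{D}_{v,d}(132,213)} x^{des(\pi_D)}y^d = \frac{1-yx}{1-y(1+x)}.\]
   Context: A diamond with $v$ vertices ($v\ge4$) is the poset with a least element, a greatest element, and $v-2$ pairwise incomparable middle elements (in a fixed left-to-right order) strictly between them. $\mathcal{D}_{v,d}$ is the set of labellings of $d$ diamonds (placed left to right) by $1,\dots,vd$, each label used once, such that in each diamond least label $<$ each middle label $<$ greatest label. For $D\in\mathcal{D}_{v,d}$, $\pi_D$ is the permutation obtained by reading the diamonds left to right and, within each diamond, the least element, then the middle elements left to right, then the greatest element. $\mathcal{D}_{v,d}(P)$ is the set of $D$ with $\pi_D$ avoiding every classical pattern in $P$. $des(\pi)$ is the number of $i$ with $\pi_i>\pi_{i+1}$. -}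

module Defs where

open import Data.Nat using (ℕ; zero; suc; _+_; _*_; _∸_; _<ᵇ_; _≡ᵇ_)
open import Data.Bool using (Bool; true; false; _∧_; not; _xor_; if_then_else_)
open import Data.List using (List; []; _∷_; map; concatMap; _++_; upTo; length; take; drop; filterᵇ; foldr)
open import Data.Bool.ListAction using (all; any)
open import Data.Integer as ℤ using (ℤ; +_; -_)

insertions : ℕ → List ℕ → List (List ℕ)
insertions x [] = (x ∷ []) ∷ []
insertions x (y ∷ ys) = (x ∷ y ∷ ys) ∷ map (y ∷_) (insertions x ys)

perms : List ℕ → List (List ℕ)
perms [] = [] ∷ []
perms (x ∷ xs) = concatMap (insertions x) (perms xs)

oneTo : ℕ → List ℕ
oneTo n = map suc (upTo n)

-- i-th entry (0-based), default 0
nth : ℕ → List ℕ → ℕ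
nth _ [] = 0
nth zero (x ∷ _) = x
nth (suc i) (_ ∷ xs) = nth i xs

-- a block of v labels (least, v-2 middles, greatest) is a valid diamond labelling:
-- least < each middle < greatest
diamondBlockOK : ℕ → List ℕ → Bool
diamondBlockOK v xs =
  all (λ i → (nth 0 xs <ᵇ nth i xs) ∧ (nth i xs <ᵇ nth (v ∸ 1) xs)) (oneTo (v ∸ 2))

isDiamondWord : ℕ → ℕ → List ℕ → Bool
isDiamondWord v d π = all (λ j → diamondBlockOK v (take v (drop (j * v) π))) (upTo d)

-- the reading words π_D for D ∈ 𝒟_{v,d}  (D ↦ π_D is a bijection)
diamondWords : ℕ → ℕ → List (List ℕ)
diamondWords v d = filterᵇ (isDiamondWord v d) (perms (oneTo (v * d)))

subseqs : ℕ → List ℕ → List (List ℕ)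
subseqs zero _ = [] ∷ []
subseqs (suc m) [] = []
subseqs (suc m) (x ∷ xs) = map (x ∷_) (subseqs m xs) ++ subseqs (suc m) xs

orderIso : List ℕ → List ℕ → Bool
orderIso p s =
  all (λ i → all (λ j → not ((nth i p <ᵇ nth j p) xor (nth i s <ᵇ nth j s)))
                 (upTo (length p)))
      (upTo (length p))

contains : List ℕ → List ℕ → Bool
contains p π = any (orderIso p) (subseqs (length p) π)

avoidsAll : List (List ℕ) → List ℕ → Bool
avoidsAll P π = all (λ p → not (contains p π)) P

des : List ℕ → ℕ
des (a ∷ b ∷ r) = (if b <ᵇ a then 1 else 0) + des (b ∷ r)
des _ = 0

p132 p213 : List ℕ
p132 = 1 ∷ 3 ∷ 2 ∷ []
p213 = 2 ∷ 1 ∷ 3 ∷ []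

count : ℕ → ℕ → ℕ → ℕ
count v d k =
  length (filterᵇ (λ π → avoidsAll (p132 ∷ p213 ∷ []) π ∧ (des π ≡ᵇ k)) (diamondWords v d))

-- formal power series in x, y over ℤ : coefficient of y^d x^k is  f d k
Series : Set
Series = ℕ → ℕ → ℤ

sumTo : ℕ → (ℕ → ℤ) → ℤ
sumTo n f = foldr ℤ._+_ (+ 0) (map f (upTo (suc n)))

_⊛_ : Series → Series → Series
(f ⊛ g) d k = sumTo d (λ i → sumTo k (λ j → f i j ℤ.* g (d ∸ i) (k ∸ j)))

lhsSeries : ℕ → Series
lhsSeries v zero zero = + 1
lhsSeries v zero (suc k) = + 0
lhsSeries v (suc d) k = + count v (suc d) k

numer : Series
numer 0 0 = + 1
numer 1 1 = - (+ 1)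
numer _ _ = + 0

denom : Series
denom 0 0 = + 1
denom 1 0 = - (+ 1)
denom 1 1 = - (+ 1)
denom _ _ = + 0

module Submission where

-- A permutation avoids 132 and 213 exactly when it is reverse layered: a concatenation of runs of
-- consecutive increasing values, each run holding larger values than everything after it.  In a
-- diamond word the least label of every diamond is below its greatest one, so no diamond straddles
-- two runs and every run has length a multiple of v; conversely every reverse-layered permutation
-- with run lengths divisible by v is a diamond word.  The counted words of d diamonds with k descents
-- therefore correspond to the compositions of d into k + 1 parts, the descents being the run
-- boundaries.  Their numbers obey Pascal's rule, which is exactly the statement that the generating
-- series times 1 - y(1 + x) is 1 - yx.

open import Defs
open import Data.Nat using (ℕ; zero; suc; _+_; _*_; _∸_; _<_; _≤_; _<ᵇ_; _≡ᵇ_; _≤?_; _<?_; _≟_;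
  z≤n; s≤s; z<s; >-nonZero)
open import Data.Nat.Properties
open import Data.Nat.Induction using (<-wellFounded)
open import Data.Integer as ℤ using (ℤ; +_; -_)
import Data.Integer.Properties as ℤ
open import Data.Bool using (Bool; true; false; not; _∧_; _xor_; T)
open import Data.Bool.Properties using (T-≡; T-∧)
open import Data.Unit using (tt)
open import Data.Empty using (⊥; ⊥-elim)
open import Data.Product as Product using (_×_; _,_; ∃; proj₁; proj₂)
open import Data.Sum using (inj₁; inj₂)
open import Data.List using (List; []; _∷_; [_]; map; concatMap; _++_; length; upTo; applyUpTo; take; drop;
  foldr; filterᵇ)
open import Data.List.Properties using (∷-injectiveˡ; ∷-injectiveʳ; ++-assoc; ++-cancelˡ; length-++; length-map;
  length-upTo; drop-drop; map-upTo; map-cong)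
open import Data.List.Membership.Propositional using (_∈_; _∉_; find; lose)
open import Data.List.Membership.Propositional.Properties using (∈-map⁻; ∈-map⁺; ∈-concatMap⁻; ∈-concatMap⁺;
  ∈-∃++; ∈-++⁻; ∈-++⁺ˡ; ∈-++⁺ʳ; ∈-upTo⁺; ∈-upTo⁻; ∈-filter⁻; ∈-filter⁺)
open import Data.List.Membership.Propositional.Properties.WithK using (unique∧set⇒bag)
open import Data.List.Relation.Unary.Any using (here; there)
open import Data.List.Relation.Unary.Any.Properties using (any⁺; any⁻)
open import Data.List.Relation.Unary.All using (All; []; _∷_)
import Data.List.Relation.Unary.All as All
import Data.List.Relation.Unary.All.Properties as All
open import Data.List.Relation.Unary.All.Properties using (all⁺; all⁻)
open import Data.List.Relation.Unary.Unique.Propositional using (Unique; []; _∷_)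
import Data.List.Relation.Unary.Unique.Propositional.Properties as Unique
open import Data.List.Relation.Binary.Permutation.Propositional
  using (_↭_; prep; swap; ↭-refl; ↭-trans; ↭-sym; ↭⇒↭ₛ)
open import Data.List.Relation.Binary.Permutation.Propositional.Properties
  using (↭-empty-inv; ∈-resp-↭; drop-mid; ↭-length)
import Data.List.Relation.Binary.Permutation.Setoid.Properties as PermutationSetoid
open import Data.List.Relation.Binary.BagAndSetEquality using (∼bag⇒↭)
open import Function using (_∘_; _⇔_; mk⇔; Equivalence)
open import Induction.WellFounded using (Acc; acc)
open import Relation.Binary using (Tri; tri<; tri≈; tri>)
open import Relation.Binary.PropositionalEquality
  using (_≡_; refl; sym; trans; cong; cong₂; subst; subst₂; setoid; module ≡-Reasoning)
open import Relation.Nullary using (¬_; yes; no)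
open import Relation.Nullary.Decidable using (T?)

-- Enumerating permutations

remove : ℕ → List ℕ → List ℕ
remove x [] = []
remove x (y ∷ ys) with x ≟ y
... | yes _ = ys
... | no _ = y ∷ remove x ys

remove-head : ∀ x ys → remove x (x ∷ ys) ≡ ys
remove-head x ys rewrite ≟-diag {x} refl = refl

remove-∈-insertions : ∀ {x ys π} → x ∉ ys → π ∈ insertions x ys → remove x π ≡ ys
remove-∈-insertions {x} {[]} _ (here refl) = remove-head x []
remove-∈-insertions {x} {y ∷ ys} _ (here refl) = remove-head x (y ∷ ys)
remove-∈-insertions {x} {y ∷ ys} x∉ys (there π∈) with ∈-map⁻ (y ∷_) π∈
... | π′ , π′∈ , refl with x ≟ y
... | yes refl = ⊥-elim (x∉ys (here refl))
... | no _ = cong (y ∷_) (remove-∈-insertions (λ x∈ys → x∉ys (there x∈ys)) π′∈)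

insertions-unique : ∀ {x} ys → x ∉ ys → Unique (insertions x ys)
insertions-unique [] _ = [] ∷ []
insertions-unique {x} (y ∷ ys) x∉ys =
  All.tabulate head-new ∷ Unique.map⁺ ∷-injectiveʳ (insertions-unique ys (λ x∈ys → x∉ys (there x∈ys)))
  where
  head-new : ∀ {π} → π ∈ map (y ∷_) (insertions x ys) → ¬ x ∷ y ∷ ys ≡ π
  head-new π∈ eq with ∈-map⁻ (y ∷_) π∈
  ... | _ , _ , refl = x∉ys (here (∷-injectiveˡ eq))

∈-insertions⇒↭ : ∀ {x} ys {π} → π ∈ insertions x ys → π ↭ x ∷ ys
∈-insertions⇒↭ [] (here refl) = ↭-refl
∈-insertions⇒↭ (y ∷ ys) (here refl) = ↭-refl
∈-insertions⇒↭ {x} (y ∷ ys) (there π∈) with ∈-map⁻ (y ∷_) π∈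
... | _ , π′∈ , refl = ↭-trans (prep y (∈-insertions⇒↭ ys π′∈)) (swap y x ↭-refl)

∈-perms⇒↭ : ∀ xs {π} → π ∈ perms xs → π ↭ xs
∈-perms⇒↭ [] (here refl) = ↭-refl
∈-perms⇒↭ (x ∷ xs) π∈ with find (∈-concatMap⁻ (insertions x) {xs = perms xs} π∈)
... | ys , ys∈ , π∈ys = ↭-trans (∈-insertions⇒↭ ys π∈ys) (prep x (∈-perms⇒↭ xs ys∈))

++-∈-insertions : ∀ x pre post → pre ++ x ∷ post ∈ insertions x (pre ++ post)
++-∈-insertions x [] [] = here refl
++-∈-insertions x [] (y ∷ post) = here refl
++-∈-insertions x (p ∷ pre) post = there (∈-map⁺ (p ∷_) (++-∈-insertions x pre post))

↭⇒∈-perms : ∀ xs {π} → π ↭ xs → π ∈ perms xs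
↭⇒∈-perms [] π↭ rewrite ↭-empty-inv π↭ = here refl
↭⇒∈-perms (x ∷ xs) π↭ with ∈-∃++ (∈-resp-↭ (↭-sym π↭) (here refl))
... | pre , post , refl =
  ∈-concatMap⁺ (insertions x) {xs = perms xs}
    (lose (↭⇒∈-perms xs (drop-mid pre [] π↭)) (++-∈-insertions x pre post))

concatMap-unique : ∀ {A B : Set} (f : A → List B) {xs} → Unique xs →
  (∀ {a} → a ∈ xs → Unique (f a)) →
  (∀ {a b z} → a ∈ xs → b ∈ xs → z ∈ f a → z ∈ f b → a ≡ b) →
  Unique (concatMap f xs)
concatMap-unique f [] _ _ = []
concatMap-unique f {a ∷ as} (a∉as ∷ as!) f! disjoint =
  Unique.++⁺ (f! (here refl))
    (concatMap-unique f as! (λ b∈ → f! (there b∈)) (λ b∈ c∈ → disjoint (there b∈) (there c∈)))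
    λ (z∈fa , z∈rest) → let (b , b∈as , z∈fb) = find (∈-concatMap⁻ f {xs = as} z∈rest) in
      All.lookup a∉as b∈as (disjoint (here refl) (there b∈as) z∈fa z∈fb)

perms-unique : ∀ xs → Unique xs → Unique (perms xs)
perms-unique [] _ = [] ∷ []
perms-unique (x ∷ xs) (x∉xs ∷ xs!) =
  concatMap-unique (insertions x) (perms-unique xs xs!)
    (λ ys∈ → insertions-unique _ (x∉ ys∈))
    (λ ys∈ zs∈ π∈ys π∈zs →
       trans (sym (remove-∈-insertions (x∉ ys∈) π∈ys)) (remove-∈-insertions (x∉ zs∈) π∈zs))
  where
  x∉ : ∀ {ys} → ys ∈ perms xs → x ∉ ys
  x∉ ys∈ x∈ys = All.lookup x∉xs (∈-resp-↭ (∈-perms⇒↭ xs ys∈) x∈ys) refl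

∈-perms-unique : ∀ xs {π} → Unique xs → π ∈ perms xs → Unique π
∈-perms-unique xs xs! π∈ =
  PermutationSetoid.Unique-resp-↭ (setoid ℕ) (↭⇒↭ₛ (↭-sym (∈-perms⇒↭ xs π∈))) xs!

unique∧set⇒length≡ : ∀ {A : Set} {xs ys : List A} → Unique xs → Unique ys →
  (∀ {z} → z ∈ xs ⇔ z ∈ ys) → length xs ≡ length ys
unique∧set⇒length≡ xs! ys! xs∼ys = ↭-length (∼bag⇒↭ (unique∧set⇒bag xs! ys! xs∼ys))

-- Compositions

-- A composition is stored as the list of its parts, each decreased by one.
size : List ℕ → ℕ
size [] = 0
size (j ∷ c) = suc j + size c

incrHead : List ℕ → List ℕ
incrHead [] = []
incrHead (j ∷ c) = suc j ∷ c

-- The compositions of n into k + 1 parts.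
compositions : ℕ → ℕ → List (List ℕ)
compositions zero k = []
compositions (suc n) zero = (n ∷ []) ∷ []
compositions (suc zero) (suc k) = []
compositions (suc (suc n)) (suc k) =
  map (0 ∷_) (compositions (suc n) k) ++ map incrHead (compositions (suc n) (suc k))

length-incrHead : ∀ c → length (incrHead c) ≡ length c
length-incrHead [] = refl
length-incrHead (_ ∷ _) = refl

size-incrHead : ∀ {c k} → length c ≡ suc k → size (incrHead c) ≡ suc (size c)
size-incrHead {_ ∷ _} _ = refl

IsComposition : ℕ → ℕ → List ℕ → Set
IsComposition n k c = size c ≡ n × length c ≡ suc k

compositions-sound : ∀ n k → All (IsComposition n k) (compositions n k)
compositions-sound zero k = []
compositions-sound (suc n) zero = (cong suc (+-identityʳ n) , refl) ∷ []
compositions-sound (suc zero) (suc k) = []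
compositions-sound (suc (suc n)) (suc k) =
  All.++⁺ (All.map⁺ (All.map (Product.map (cong suc) (cong suc)) (compositions-sound (suc n) k)))
          (All.map⁺ (All.map (λ {c} (size≡ , length≡) →
                       trans (size-incrHead {c} length≡) (cong suc size≡) , trans (length-incrHead c) length≡)
                     (compositions-sound (suc n) (suc k))))

∈-compositions⁻ : ∀ n k {c} → c ∈ compositions n k → IsComposition n k c
∈-compositions⁻ n k = All.lookup (compositions-sound n k)

∈-compositions⁺ : ∀ n k c → size c ≡ n → length c ≡ suc k → c ∈ compositions n k
∈-compositions⁺ _ zero (j ∷ []) refl refl rewrite +-identityʳ j = here refl
∈-compositions⁺ _ (suc k) (zero ∷ j ∷ c) refl length≡ =
  ∈-++⁺ˡ (∈-map⁺ (0 ∷_) (∈-compositions⁺ _ k (j ∷ c) refl (suc-injective length≡)))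
∈-compositions⁺ _ (suc k) (suc j ∷ c) refl length≡ =
  ∈-++⁺ʳ _ (∈-map⁺ incrHead {x = j ∷ c} (∈-compositions⁺ _ (suc k) (j ∷ c) refl length≡))
∈-compositions⁺ _ zero (j ∷ _ ∷ _) _ ()
∈-compositions⁺ _ (suc k) (zero ∷ []) _ ()

incrHead-injective : ∀ {c c′} → incrHead c ≡ incrHead c′ → c ≡ c′
incrHead-injective {[]} {[]} _ = refl
incrHead-injective {_ ∷ _} {_ ∷ _} refl = refl

compositions-unique : ∀ n k → Unique (compositions n k)
compositions-unique zero k = []
compositions-unique (suc n) zero = [] ∷ []
compositions-unique (suc zero) (suc k) = []
compositions-unique (suc (suc n)) (suc k) =
  Unique.++⁺ (Unique.map⁺ ∷-injectiveʳ (compositions-unique (suc n) k))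
             (Unique.map⁺ incrHead-injective (compositions-unique (suc n) (suc k)))
             λ (c∈₁ , c∈₂) → first-part-differs (∈-map⁻ (0 ∷_) c∈₁) (∈-map⁻ incrHead c∈₂)
  where
  first-part-differs : ∀ {c : List ℕ} →
    (∃ λ c₁ → c₁ ∈ compositions (suc n) k × c ≡ 0 ∷ c₁) →
    (∃ λ c₂ → c₂ ∈ compositions (suc n) (suc k) × c ≡ incrHead c₂) → ⊥
  first-part-differs (_ , _ , refl) ([] , _ , ())
  first-part-differs (_ , _ , refl) (_ ∷ _ , _ , ())

length-compositions-suc : ∀ n k → length (compositions (suc (suc n)) (suc k)) ≡
  length (compositions (suc n) k) + length (compositions (suc n) (suc k))
length-compositions-suc n k =
  trans (length-++ (map (0 ∷_) (compositions (suc n) k)))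
        (cong₂ _+_ (length-map (0 ∷_) (compositions (suc n) k))
                   (length-map incrHead (compositions (suc n) (suc k))))

-- Avoiding 132 and 213

<ᵇ-true : ∀ {m n} → m < n → (m <ᵇ n) ≡ true
<ᵇ-true m<n = Equivalence.to T-≡ (<⇒<ᵇ m<n)

<ᵇ-false : ∀ {m n} → ¬ m < n → (m <ᵇ n) ≡ false
<ᵇ-false {m} {n} m≮n with m <ᵇ n in eq
... | false = refl
... | true = ⊥-elim (m≮n (<ᵇ⇒< m n (Equivalence.from T-≡ eq)))

data Subseq : List ℕ → List ℕ → Set where
  []   : ∀ {ys} → Subseq [] ys
  keep : ∀ {x xs ys} → Subseq xs ys → Subseq (x ∷ xs) (x ∷ ys)
  skip : ∀ {y xs ys} → Subseq xs ys → Subseq xs (y ∷ ys)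

∈-subseqs⁻ : ∀ m π {s} → s ∈ subseqs m π → Subseq s π × length s ≡ m
∈-subseqs⁻ zero π (here refl) = [] , refl
∈-subseqs⁻ (suc m) (x ∷ π) s∈ with ∈-++⁻ (map (x ∷_) (subseqs m π)) s∈
... | inj₂ s∈′ = let (sub , len) = ∈-subseqs⁻ (suc m) π s∈′ in skip sub , len
... | inj₁ s∈′ with ∈-map⁻ (x ∷_) s∈′
... | s′ , s′∈ , refl = let (sub , len) = ∈-subseqs⁻ m π s′∈ in keep sub , cong suc len

∈-subseqs⁺ : ∀ {s π} → Subseq s π → s ∈ subseqs (length s) π
∈-subseqs⁺ {π = []} [] = here refl
∈-subseqs⁺ {π = x ∷ π} [] = here refl
∈-subseqs⁺ (keep {x} sub) = ∈-++⁺ˡ (∈-map⁺ (x ∷_) (∈-subseqs⁺ sub))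
∈-subseqs⁺ (skip {y} {[]} sub) = here refl
∈-subseqs⁺ (skip {y} {x ∷ xs} {ys} sub) = ∈-++⁺ʳ (map (y ∷_) (subseqs (length xs) ys)) (∈-subseqs⁺ sub)

Subseq-head-∈ : ∀ {x s π} → Subseq (x ∷ s) π → x ∈ π
Subseq-head-∈ (keep _) = here refl
Subseq-head-∈ (skip sub) = there (Subseq-head-∈ sub)

Subseq-tail : ∀ {x s π} → Subseq (x ∷ s) π → Subseq s π
Subseq-tail (keep sub) = skip sub
Subseq-tail (skip sub) = skip (Subseq-tail sub)

Subseq-++ʳ : ∀ xs {s ys} → Subseq s ys → Subseq s (xs ++ ys)
Subseq-++ʳ [] sub = sub
Subseq-++ʳ (x ∷ xs) sub = skip (Subseq-++ʳ xs sub)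

Subseq-++⁻ : ∀ xs {ys s} → Subseq s (xs ++ ys) → ∃ λ s₁ → ∃ λ s₂ → s ≡ s₁ ++ s₂ × Subseq s₁ xs × Subseq s₂ ys
Subseq-++⁻ [] sub = [] , _ , refl , [] , sub
Subseq-++⁻ (x ∷ xs) [] = [] , [] , refl , [] , []
Subseq-++⁻ (x ∷ xs) (keep sub) with Subseq-++⁻ xs sub
... | s₁ , s₂ , refl , sub₁ , sub₂ = x ∷ s₁ , s₂ , refl , keep sub₁ , sub₂
Subseq-++⁻ (x ∷ xs) (skip sub) with Subseq-++⁻ xs sub
... | s₁ , s₂ , refl , sub₁ , sub₂ = s₁ , s₂ , refl , skip sub₁ , sub₂

∈-++-Subseq : ∀ {x} xs {s ys} → x ∈ xs → Subseq s ys → Subseq (x ∷ s) (xs ++ ys)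
∈-++-Subseq (y ∷ xs) (here refl) sub = keep (Subseq-++ʳ xs sub)
∈-++-Subseq (y ∷ xs) (there x∈) sub = skip (∈-++-Subseq xs x∈ sub)

∈⇒Subseq : ∀ {z ys} → z ∈ ys → Subseq (z ∷ []) ys
∈⇒Subseq (here refl) = keep []
∈⇒Subseq (there z∈) = skip (∈⇒Subseq z∈)

Shape132 Shape213 : ℕ → ℕ → ℕ → Set
Shape132 x y z = x < y × x < z × z < y
Shape213 x y z = y < x × x < z × y < z

Avoids132∧213 : List ℕ → Set
Avoids132∧213 π = ∀ x y z → Subseq (x ∷ y ∷ z ∷ []) π → ¬ Shape132 x y z × ¬ Shape213 x y z

orderIso-entry : ∀ p s {i j} → T (orderIso p s) → i < length p → j < length p →
  T (not ((nth i p <ᵇ nth j p) xor (nth i s <ᵇ nth j s)))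
orderIso-entry p s {i} {j} iso i< j< =
  All.lookup (all⁺ _ _ (All.lookup (all⁺ _ _ iso) (∈-upTo⁺ i<))) (∈-upTo⁺ j<)

-- For concrete p, i and j the instance arguments reduce to T true and are found automatically.
orderIso-< : ∀ p s {i j} → T (orderIso p s) →
  {{T (i <ᵇ length p)}} → {{T (j <ᵇ length p)}} → {{T (nth i p <ᵇ nth j p)}} → nth i s < nth j s
orderIso-< p s {i} {j} iso {{i<}} {{j<}} {{pi<pj}}
  with nth i p <ᵇ nth j p | orderIso-entry p s iso (<ᵇ⇒< i _ i<) (<ᵇ⇒< j _ j<)
... | true | entry = <ᵇ⇒< _ _ (T-not-not entry)
  where
  T-not-not : ∀ {b} → T (not (not b)) → T b
  T-not-not {true} _ = tt

orderIso⇒Shape132 : ∀ x y z → T (orderIso p132 (x ∷ y ∷ z ∷ [])) → Shape132 x y z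
orderIso⇒Shape132 x y z iso =
  orderIso-< p132 s {0} {1} iso , orderIso-< p132 s {0} {2} iso , orderIso-< p132 s {2} {1} iso
  where s = x ∷ y ∷ z ∷ []

orderIso⇒Shape213 : ∀ x y z → T (orderIso p213 (x ∷ y ∷ z ∷ [])) → Shape213 x y z
orderIso⇒Shape213 x y z iso =
  orderIso-< p213 s {1} {0} iso , orderIso-< p213 s {0} {2} iso , orderIso-< p213 s {1} {2} iso
  where s = x ∷ y ∷ z ∷ []

Shape132⇒orderIso : ∀ x y z → Shape132 x y z → T (orderIso p132 (x ∷ y ∷ z ∷ []))
Shape132⇒orderIso x y z (x<y , x<z , z<y)
  rewrite <ᵇ-false (n≮n x) | <ᵇ-false (n≮n y) | <ᵇ-false (n≮n z)
        | <ᵇ-true x<y | <ᵇ-true x<z | <ᵇ-true z<y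
        | <ᵇ-false (<⇒≯ x<y) | <ᵇ-false (<⇒≯ x<z) | <ᵇ-false (<⇒≯ z<y) = tt

Shape213⇒orderIso : ∀ x y z → Shape213 x y z → T (orderIso p213 (x ∷ y ∷ z ∷ []))
Shape213⇒orderIso x y z (y<x , x<z , y<z)
  rewrite <ᵇ-false (n≮n x) | <ᵇ-false (n≮n y) | <ᵇ-false (n≮n z)
        | <ᵇ-true y<x | <ᵇ-true x<z | <ᵇ-true y<z
        | <ᵇ-false (<⇒≯ y<x) | <ᵇ-false (<⇒≯ x<z) | <ᵇ-false (<⇒≯ y<z) = tt

module _ (p : List ℕ) (π : List ℕ) where

  Subseq⇒contains : ∀ {s} → Subseq s π → T (orderIso p s) → length s ≡ length p → T (contains p π)
  Subseq⇒contains {s} sub iso len = any⁺ (orderIso p) (lose (subst (λ n → s ∈ subseqs n π) len (∈-subseqs⁺ sub)) iso)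

  contains⇒Subseq : T (contains p π) → ∃ λ s → Subseq s π × length s ≡ length p × T (orderIso p s)
  contains⇒Subseq c with find (any⁻ (orderIso p) _ c)
  ... | s , s∈ , iso = let (sub , len) = ∈-subseqs⁻ (length p) π s∈ in s , sub , len , iso

T-not⇒¬T : ∀ {b} → T (not b) → ¬ T b
T-not⇒¬T {false} _ ()

¬T⇒T-not : ∀ {b} → ¬ T b → T (not b)
¬T⇒T-not {false} _ = tt
¬T⇒T-not {true} ¬b = ¬b tt

avoids⇒Avoids132∧213 : ∀ π → T (avoidsAll (p132 ∷ p213 ∷ []) π) → Avoids132∧213 π
avoids⇒Avoids132∧213 π av x y z sub with all⁺ (λ q → not (contains q π)) (p132 ∷ p213 ∷ []) av
... | ¬132 ∷ ¬213 ∷ [] =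
  (λ shape → T-not⇒¬T ¬132 (Subseq⇒contains p132 π sub (Shape132⇒orderIso x y z shape) refl)) ,
  (λ shape → T-not⇒¬T ¬213 (Subseq⇒contains p213 π sub (Shape213⇒orderIso x y z shape) refl))

Avoids132∧213⇒avoids : ∀ π → Avoids132∧213 π → T (avoidsAll (p132 ∷ p213 ∷ []) π)
Avoids132∧213⇒avoids π av = all⁻ (λ q → not (contains q π)) {p132 ∷ p213 ∷ []} (¬T⇒T-not ¬contains132 ∷ ¬T⇒T-not ¬contains213 ∷ [])
  where
  ¬contains132 : ¬ T (contains p132 π)
  ¬contains132 c with contains⇒Subseq p132 π c
  ... | x ∷ y ∷ z ∷ [] , sub , refl , iso = proj₁ (av x y z sub) (orderIso⇒Shape132 x y z iso)
  ¬contains213 : ¬ T (contains p213 π)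
  ¬contains213 c with contains⇒Subseq p213 π c
  ... | x ∷ y ∷ z ∷ [] , sub , refl , iso = proj₂ (av x y z sub) (orderIso⇒Shape213 x y z iso)

-- Runs and diamond blocks

run : ℕ → ℕ → List ℕ
run a zero = []
run a (suc l) = a ∷ run (suc a) l

length-run : ∀ a l → length (run a l) ≡ l
length-run a zero = refl
length-run a (suc l) = cong suc (length-run (suc a) l)

∈-run⁻ : ∀ a l {x} → x ∈ run a l → a ≤ x × x < a + l
∈-run⁻ a (suc l) (here refl) = ≤-refl , m<m+n a z<s
∈-run⁻ a (suc l) {x} (there x∈) with ∈-run⁻ (suc a) l x∈
... | a<x , x< = <⇒≤ a<x , subst (x <_) (sym (+-suc a l)) x<

∈-run⁺ : ∀ a l {x} → a ≤ x → x < a + l → x ∈ run a l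
∈-run⁺ a zero {x} a≤x x< = ⊥-elim (<-irrefl refl (≤-<-trans a≤x (subst (x <_) (+-identityʳ a) x<)))
∈-run⁺ a (suc l) {x} a≤x x< with a ≟ x
... | yes refl = here refl
... | no a≢x = there (∈-run⁺ (suc a) l (≤∧≢⇒< a≤x a≢x) (subst (x <_) (+-suc a l) x<))

run-unique : ∀ a l → Unique (run a l)
run-unique a zero = []
run-unique a (suc l) = All.tabulate (λ x∈ a≡x → <-irrefl a≡x (proj₁ (∈-run⁻ (suc a) l x∈))) ∷ run-unique (suc a) l

run-suc : ∀ a l → run a (suc l) ≡ run a l ++ [ a + l ]
run-suc a zero = cong [_] (sym (+-identityʳ a))
run-suc a (suc l) = cong (a ∷_) (trans (run-suc (suc a) l) (cong (λ b → run (suc a) l ++ [ b ]) (sym (+-suc a l))))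

drop-run : ∀ k a r σ → drop k (run a (k + r) ++ σ) ≡ run (k + a) r ++ σ
drop-run zero a r σ = refl
drop-run (suc k) a r σ = trans (drop-run k (suc a) r σ) (cong (λ b → run b r ++ σ) (+-suc k a))

take-run : ∀ k a r σ → take k (run a (k + r) ++ σ) ≡ run a k
take-run zero a r σ = refl
take-run (suc k) a r σ = cong (a ∷_) (take-run k (suc a) r σ)

nth-run : ∀ {i} a l → i < l → nth i (run a l) ≡ a + i
nth-run {zero} a (suc l) _ = sym (+-identityʳ a)
nth-run {suc i} a (suc l) (s≤s i<l) = trans (nth-run (suc a) l i<l) (sym (+-suc a i))

nth-take : ∀ i n (xs : List ℕ) → i < n → nth i (take n xs) ≡ nth i xs
nth-take i (suc n) [] _ = refl
nth-take zero (suc n) (x ∷ xs) _ = refl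
nth-take (suc i) (suc n) (x ∷ xs) (s≤s i<n) = nth-take i n xs i<n

nth-++ : ∀ (xs : List ℕ) t ys → nth (length xs + t) (xs ++ ys) ≡ nth t ys
nth-++ [] t ys = refl
nth-++ (x ∷ xs) t ys = nth-++ xs t ys

nth-∈ : ∀ t (ys : List ℕ) → t < length ys → nth t ys ∈ ys
nth-∈ zero (y ∷ ys) _ = here refl
nth-∈ (suc t) (y ∷ ys) (s≤s t<) = there (nth-∈ t ys t<)

IsPermOf : ℕ → List ℕ → Set
IsPermOf m π = Unique π × (∀ {x} → x ∈ π → 0 < x × x ≤ m) × (∀ {x} → 0 < x → x ≤ m → x ∈ π)

∈-oneTo⁻ : ∀ {m x} → x ∈ oneTo m → 0 < x × x ≤ m
∈-oneTo⁻ x∈ with ∈-map⁻ suc x∈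
... | _ , i∈ , refl = z<s , ∈-upTo⁻ i∈

∈-oneTo⁺ : ∀ {m x} → 0 < x → x ≤ m → x ∈ oneTo m
∈-oneTo⁺ {x = suc i} _ x≤m = ∈-map⁺ suc (∈-upTo⁺ x≤m)

oneTo-unique : ∀ m → Unique (oneTo m)
oneTo-unique m = Unique.map⁺ suc-injective (Unique.upTo⁺ m)

∈-perms-oneTo⇒IsPermOf : ∀ m {π} → π ∈ perms (oneTo m) → IsPermOf m π
∈-perms-oneTo⇒IsPermOf m π∈ =
  ∈-perms-unique (oneTo m) (oneTo-unique m) π∈ ,
  (λ x∈ → ∈-oneTo⁻ (∈-resp-↭ (∈-perms⇒↭ (oneTo m) π∈) x∈)) ,
  (λ 0<x x≤m → ∈-resp-↭ (↭-sym (∈-perms⇒↭ (oneTo m) π∈)) (∈-oneTo⁺ 0<x x≤m))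

IsPermOf⇒∈-perms-oneTo : ∀ m {π} → IsPermOf m π → π ∈ perms (oneTo m)
IsPermOf⇒∈-perms-oneTo m (π! , bounded , complete) = ↭⇒∈-perms (oneTo m)
  (∼bag⇒↭ (unique∧set⇒bag π! (oneTo-unique m)
    (mk⇔ (λ x∈ → let (0<x , x≤m) = bounded x∈ in ∈-oneTo⁺ 0<x x≤m)
         (λ x∈ → let (0<x , x≤m) = ∈-oneTo⁻ x∈ in complete 0<x x≤m))))

length-IsPermOf : ∀ m {π} → IsPermOf m π → length π ≡ m
length-IsPermOf m perm =
  trans (↭-length (∈-perms⇒↭ (oneTo m) (IsPermOf⇒∈-perms-oneTo m perm)))
        (trans (length-map suc (upTo m)) (length-upTo m))

DiamondBlocks : ℕ → ℕ → List ℕ → Set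
DiamondBlocks v D π = ∀ i → i < D → T (diamondBlockOK v (take v (drop (i * v) π)))

isDiamondWord⇒DiamondBlocks : ∀ v D π → T (isDiamondWord v D π) → DiamondBlocks v D π
isDiamondWord⇒DiamondBlocks v D π w i i<D = All.lookup (all⁺ _ (upTo D) w) (∈-upTo⁺ i<D)

DiamondBlocks⇒isDiamondWord : ∀ v D π → DiamondBlocks v D π → T (isDiamondWord v D π)
DiamondBlocks⇒isDiamondWord v D π blocks =
  all⁻ (λ j → diamondBlockOK v (take v (drop (j * v) π))) (All.tabulate (λ i∈ → blocks _ (∈-upTo⁻ i∈)))

DiamondBlocks-drop : ∀ v E π → DiamondBlocks v (suc E) π → DiamondBlocks v E (drop v π)
DiamondBlocks-drop v E π blocks i i<E =
  subst (λ σ → T (diamondBlockOK v (take v σ))) (sym (drop-drop v (i * v) π)) (blocks (suc i) (s≤s i<E))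

DiamondBlocks-cons : ∀ v E π → T (diamondBlockOK v (take v π)) → DiamondBlocks v E (drop v π) →
  DiamondBlocks v (suc E) π
DiamondBlocks-cons v E π first rest zero _ = first
DiamondBlocks-cons v E π first rest (suc i) (s≤s i<E) =
  subst (λ σ → T (diamondBlockOK v (take v σ))) (drop-drop v (i * v) π) (rest i i<E)

run-diamondBlockOK : ∀ v a → T (diamondBlockOK v (run a v))
run-diamondBlockOK zero a = tt
run-diamondBlockOK (suc zero) a = tt
run-diamondBlockOK (suc (suc zero)) a = tt
run-diamondBlockOK v@(suc (suc (suc w))) a = all⁻ _ (All.tabulate middle-ok)
  where
  R = run a v
  middle-ok : ∀ {i} → i ∈ oneTo (suc w) → T ((nth 0 R <ᵇ nth i R) ∧ (nth i R <ᵇ nth (v ∸ 1) R))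
  middle-ok {i} i∈ with ∈-oneTo⁻ i∈
  ... | 0<i , i≤w+1 = Equivalence.from T-∧ (<⇒<ᵇ first<middle , <⇒<ᵇ middle<last)
    where
    i<v : i < v
    i<v = m<n⇒m<1+n (s≤s i≤w+1)
    first<middle : nth 0 R < nth i R
    first<middle = subst₂ _<_ (sym (nth-run a v z<s)) (sym (nth-run a v i<v)) (+-monoʳ-< a 0<i)
    middle<last : nth i R < nth (v ∸ 1) R
    middle<last = subst₂ _<_ (sym (nth-run a v i<v)) (sym (nth-run a v ≤-refl)) (+-monoʳ-< a (s≤s i≤w+1))

diamondBlockOK⇒first<last : ∀ v B → 3 ≤ v → T (diamondBlockOK v B) → nth 0 B < nth (v ∸ 1) B
diamondBlockOK⇒first<last v@(suc (suc (suc w))) B (s≤s (s≤s (s≤s _))) ok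
  with Equivalence.to T-∧ (All.lookup (all⁺ _ (oneTo (suc w)) ok) (∈-oneTo⁺ {suc w} {1} z<s (s≤s z≤n)))
... | first<middle , middle<last = <-trans (<ᵇ⇒< _ _ first<middle) (<ᵇ⇒< _ _ middle<last)

DiamondBlocks-run++⁺ : ∀ v {E σ} → DiamondBlocks v E σ → ∀ k a → DiamondBlocks v (k + E) (run a (v * k) ++ σ)
DiamondBlocks-run++⁺ v {E} {σ} blocks zero a = subst (λ l → DiamondBlocks v E (run a l ++ σ)) (sym (*-zeroʳ v)) blocks
DiamondBlocks-run++⁺ v {E} {σ} blocks (suc k) a =
  subst (λ l → DiamondBlocks v (suc (k + E)) (run a l ++ σ)) (sym (*-suc v k))
    (DiamondBlocks-cons v (k + E) (run a (v + v * k) ++ σ)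
      (subst (T ∘ diamondBlockOK v) (sym (take-run v a (v * k) σ)) (run-diamondBlockOK v a))
      (subst (DiamondBlocks v (k + E)) (sym (drop-run v a (v * k) σ)) (DiamondBlocks-run++⁺ v blocks k (v + a))))

DiamondBlocks-run++⁻ : ∀ v {E σ} k a → DiamondBlocks v (k + E) (run a (v * k) ++ σ) → DiamondBlocks v E σ
DiamondBlocks-run++⁻ v {E} {σ} zero a blocks = subst (λ l → DiamondBlocks v E (run a l ++ σ)) (*-zeroʳ v) blocks
DiamondBlocks-run++⁻ v {E} {σ} (suc k) a blocks =
  DiamondBlocks-run++⁻ v k (v + a)
    (subst (DiamondBlocks v (k + E)) (drop-run v a (v * k) σ)
      (DiamondBlocks-drop v (k + E) (run a (v + v * k) ++ σ)
        (subst (λ l → DiamondBlocks v (suc (k + E)) (run a l ++ σ)) (*-suc v k) blocks)))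

-- Avoiders are reverse layered

Unique-++-disjoint : ∀ (xs : List ℕ) {ys x} → Unique (xs ++ ys) → x ∈ xs → x ∈ ys → ⊥
Unique-++-disjoint (y ∷ xs) (y∉ ∷ _) (here refl) x∈ys = All.lookup y∉ (∈-++⁺ʳ xs x∈ys) refl
Unique-++-disjoint (y ∷ xs) (_ ∷ xs!) (there x∈xs) x∈ys = Unique-++-disjoint xs xs! x∈xs x∈ys

Unique-++ʳ : ∀ (xs : List ℕ) {ys} → Unique (xs ++ ys) → Unique ys
Unique-++ʳ [] ys! = ys!
Unique-++ʳ (x ∷ xs) (_ ∷ xs!) = Unique-++ʳ xs xs!

last∈run : ∀ a l → a + l ∈ run a (suc l)
last∈run a l = ∈-run⁺ a (suc l) (m≤m+n a l) (subst (a + l <_) (sym (+-suc a l)) ≤-refl)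

-- With c right after the run a, …, b and b + 1 further right, b c (b + 1) is a 132 (c > b + 1) or a 213 (c < b).
successor-follows-run : ∀ a l c τ → Unique (run a (suc l) ++ c ∷ τ) → Avoids132∧213 (run a (suc l) ++ c ∷ τ) →
  ¬ suc (a + l) ∈ τ
successor-follows-run a l c τ π! avoids b+1∈τ = compare (<-cmp c (suc b))
  where
  R = run a (suc l)
  b = a + l
  b,c,b+1 : Subseq (b ∷ c ∷ suc b ∷ []) (R ++ c ∷ τ)
  b,c,b+1 = ∈-++-Subseq R (last∈run a l) (keep (∈⇒Subseq b+1∈τ))
  compare : Tri (c < suc b) (c ≡ suc b) (suc b < c) → ⊥
  compare (tri≈ _ refl _) with Unique-++ʳ R π!
  ... | c∉τ ∷ _ = All.lookup c∉τ b+1∈τ refl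
  compare (tri> _ _ b+1<c) = proj₁ (avoids b c (suc b) b,c,b+1) (<-trans (n<1+n b) b+1<c , n<1+n b , b+1<c)
  compare (tri< c<b+1 _ _) = proj₂ (avoids b c (suc b) b,c,b+1) (c<b , n<1+n b , c<b+1)
    where
    c<b : c < b
    c<b = ≤∧≢⇒< (≤-pred c<b+1) (λ c≡b → Unique-++-disjoint R π! (last∈run a l) (here (sym c≡b)))

run-extends : ∀ a l τ m → IsPermOf m (run a (suc l) ++ τ) → Avoids132∧213 (run a (suc l) ++ τ) →
  suc (a + l) ≤ m → ∃ λ τ′ → τ ≡ suc (a + l) ∷ τ′
run-extends a l τ m (π! , _ , complete) avoids b<m with ∈-++⁻ (run a (suc l)) (complete z<s b<m)
... | inj₁ b+1∈R = ⊥-elim (n≮n _ (subst (suc (a + l) <_) (+-suc a l) (proj₂ (∈-run⁻ a (suc l) b+1∈R))))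
... | inj₂ (here refl) = _ , refl
... | inj₂ (there b+1∈τ′) = ⊥-elim (successor-follows-run a l _ _ π! avoids b+1∈τ′)

run-prefix : ∀ m a rest → IsPermOf m (a ∷ rest) → Avoids132∧213 (a ∷ rest) →
  ∀ l → a + l ≤ m → ∃ λ τ → a ∷ rest ≡ run a (suc l) ++ τ
run-prefix m a rest perm avoids zero _ = rest , refl
run-prefix m a rest perm avoids (suc l) a+l+1≤m
  with run-prefix m a rest perm avoids l (≤-trans (+-monoʳ-≤ a (n≤1+n l)) a+l+1≤m)
... | τ , π≡ with run-extends a l τ m (subst (IsPermOf m) π≡ perm) (subst Avoids132∧213 π≡ avoids)
                    (subst (_≤ m) (+-suc a l) a+l+1≤m)
... | τ′ , refl = τ′ , (begin
  a ∷ rest                                   ≡⟨ π≡ ⟩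
  run a (suc l) ++ suc (a + l) ∷ τ′          ≡⟨ ++-assoc (run a (suc l)) [ suc (a + l) ] τ′ ⟨
  (run a (suc l) ++ [ suc (a + l) ]) ++ τ′   ≡⟨ cong (λ b → (run a (suc l) ++ [ b ]) ++ τ′) (+-suc a l) ⟨
  (run a (suc l) ++ [ a + suc l ]) ++ τ′     ≡⟨ cong (_++ τ′) (run-suc a (suc l)) ⟨
  run a (suc (suc l)) ++ τ′                  ∎)
  where open ≡-Reasoning

record RunDecomposition (m a : ℕ) (π : List ℕ) : Set where
  field
    a′ r : ℕ
    a≡ : a ≡ suc a′
    a′+r≡m : a′ + r ≡ m
    0<r : 0 < r
    σ : List ℕ
    π≡ : π ≡ run a r ++ σ
    σ-perm : IsPermOf a′ σ
    σ-avoids : Avoids132∧213 σ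
    σ<a : ∀ {x} → x ∈ σ → x < a

run-decomposition : ∀ m a rest → IsPermOf m (a ∷ rest) → Avoids132∧213 (a ∷ rest) → RunDecomposition m a (a ∷ rest)
run-decomposition m a rest perm@(π! , bounded , complete) avoids with bounded (here refl)
... | s≤s {n = a′} z≤n , a≤m with run-prefix m (suc a′) rest perm avoids (m ∸ suc a′) (≤-reflexive (m+[n∸m]≡n a≤m))
... | τ , π≡ = record
  { a′ = a′ ; r = r ; a≡ = refl
  ; a′+r≡m = trans (+-suc a′ (m ∸ suc a′)) (m+[n∸m]≡n a≤m)
  ; 0<r = z<s ; σ = τ ; π≡ = π≡
  ; σ-perm = Unique-++ʳ R R++τ! , τ-bounded , τ-complete
  ; σ-avoids = λ x y z sub → avoids x y z (subst (Subseq _) (sym π≡) (Subseq-++ʳ R sub))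
  ; σ<a = τ<a }
  where
  r = suc (m ∸ suc a′)
  R = run (suc a′) r
  R++τ! : Unique (R ++ τ)
  R++τ! = subst Unique π≡ π!
  ∈τ⇒∈π : ∀ {x} → x ∈ τ → x ∈ suc a′ ∷ rest
  ∈τ⇒∈π {x} x∈τ = subst (x ∈_) (sym π≡) (∈-++⁺ʳ R x∈τ)
  a+r≡ : suc a′ + r ≡ suc m
  a+r≡ = trans (+-suc (suc a′) (m ∸ suc a′)) (cong suc (m+[n∸m]≡n a≤m))
  τ<a : ∀ {x} → x ∈ τ → x < suc a′
  τ<a {x} x∈τ with x <? suc a′
  ... | yes x<a = x<a
  ... | no x≮a = ⊥-elim (Unique-++-disjoint R R++τ!
          (∈-run⁺ (suc a′) r (≮⇒≥ x≮a) (subst (x <_) (sym a+r≡) (s≤s (proj₂ (bounded (∈τ⇒∈π x∈τ)))))) x∈τ)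
  τ-bounded : ∀ {x} → x ∈ τ → 0 < x × x ≤ a′
  τ-bounded x∈τ = proj₁ (bounded (∈τ⇒∈π x∈τ)) , ≤-pred (τ<a x∈τ)
  τ-complete : ∀ {x} → 0 < x → x ≤ a′ → x ∈ τ
  τ-complete {x} 0<x x≤a′ with ∈-++⁻ R (subst (x ∈_) π≡ (complete 0<x (≤-trans x≤a′ (≤-trans (n≤1+n a′) a≤m))))
  ... | inj₂ x∈τ = x∈τ
  ... | inj₁ x∈R = ⊥-elim (n≮n x (≤-trans (s≤s x≤a′) (proj₁ (∈-run⁻ (suc a′) r x∈R))))

run++smaller-block-decreases : ∀ a r t σ → 0 < r → t < length σ → (∀ {x} → x ∈ σ → x < a) →
  let B = take (suc (r + t)) (run a r ++ σ) in nth (r + t) B < nth 0 B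
run++smaller-block-decreases a (suc r) t σ _ t< σ<a = σ<a (subst (_∈ σ) (sym last≡) (nth-∈ t σ t<))
  where
  last≡ : nth (suc r + t) (take (suc (suc r + t)) (run a (suc r) ++ σ)) ≡ nth t σ
  last≡ = begin
    nth (suc r + t) (take (suc (suc r + t)) (run a (suc r) ++ σ))  ≡⟨ nth-take (suc r + t) _ (run a (suc r) ++ σ) ≤-refl ⟩
    nth (suc r + t) (run a (suc r) ++ σ)                           ≡⟨ cong (λ n → nth (n + t) (run a (suc r) ++ σ)) (length-run a (suc r)) ⟨
    nth (length (run a (suc r)) + t) (run a (suc r) ++ σ)          ≡⟨ nth-++ (run a (suc r)) t σ ⟩
    nth t σ                                                        ∎
    where open ≡-Reasoning

-- Within a diamond the least label is below the greatest, so a diamond cannot reach past the first run into σ.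
first-run-covers-block : ∀ v r a σ → 3 ≤ v → 0 < r → v ≤ r + length σ → (∀ {x} → x ∈ σ → x < a) →
  T (diamondBlockOK v (take v (run a r ++ σ))) → v ≤ r
first-run-covers-block v r a σ 3≤v 0<r v≤ σ<a ok with r <? v
... | no r≮v = ≮⇒≥ r≮v
... | yes r<v with m≤n⇒∃[o]m+o≡n r<v
...   | t , refl = ⊥-elim (<-asym (diamondBlockOK⇒first<last _ (take (suc (r + t)) (run a r ++ σ)) 3≤v ok)
                     (run++smaller-block-decreases a r t σ 0<r (+-cancelˡ-< r t (length σ) v≤) σ<a))

run-length-multiple : ∀ v → 3 ≤ v → ∀ D a r σ → 0 < r → DiamondBlocks v D (run a r ++ σ) →
  (∀ {x} → x ∈ σ → x < a) → r + length σ ≡ v * D → ∃ λ j → r ≡ v * suc j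
run-length-multiple v 3≤v zero a (suc r) σ _ _ _ len with () ← trans len (*-zeroʳ v)
run-length-multiple v 3≤v (suc D) a r σ 0<r blocks σ<a len
  with m≤n⇒∃[o]m+o≡n (first-run-covers-block v r a σ 3≤v 0<r v≤ σ<a (blocks 0 z<s))
  where
  v≤ : v ≤ r + length σ
  v≤ = subst (v ≤_) (trans (sym (*-suc v D)) (sym len)) (m≤m+n v (v * D))
... | zero , refl = 0 , trans (+-identityʳ v) (sym (*-identityʳ v))
... | suc r′ , refl with run-length-multiple v 3≤v D (v + a) (suc r′) σ z<s rest-blocks rest-σ<a rest-len
  where
  rest-blocks : DiamondBlocks v D (run (v + a) (suc r′) ++ σ)
  rest-blocks = subst (DiamondBlocks v D) (drop-run v a (suc r′) σ) (DiamondBlocks-drop v D _ blocks)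
  rest-σ<a : ∀ {x} → x ∈ σ → x < v + a
  rest-σ<a x∈σ = <-≤-trans (σ<a x∈σ) (m≤n+m a v)
  rest-len : suc r′ + length σ ≡ v * D
  rest-len = +-cancelˡ-≡ v _ _ (trans (sym (+-assoc v (suc r′) (length σ))) (trans len (*-suc v D)))
... | j , r′≡ = suc j , trans (cong (_+_ v) r′≡) (sym (*-suc v (suc j)))

-- Counting diamond words

layered : ℕ → List ℕ → List ℕ
layered v [] = []
layered v (j ∷ c) = run (suc (v * size c)) (v * suc j) ++ layered v c

length-layered : ∀ v c → length (layered v c) ≡ v * size c
length-layered v [] = sym (*-zeroʳ v)
length-layered v (j ∷ c) = begin
  length (run _ (v * suc j) ++ layered v c)             ≡⟨ length-++ (run (suc (v * size c)) (v * suc j)) ⟩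
  length (run _ (v * suc j)) + length (layered v c)     ≡⟨ cong₂ _+_ (length-run _ (v * suc j)) (length-layered v c) ⟩
  v * suc j + v * size c                                ≡⟨ *-distribˡ-+ v (suc j) (size c) ⟨
  v * size (j ∷ c)                                      ∎
  where open ≡-Reasoning

layered-injective : ∀ v {c c′} → layered (suc v) c ≡ layered (suc v) c′ → c ≡ c′
layered-injective v {[]} {[]} _ = refl
layered-injective v {j ∷ c} {j′ ∷ c′} eq = cong₂ _∷_ j≡j′ (layered-injective v c≡c′)
  where
  w = suc v
  size≡ : size c ≡ size c′
  size≡ = *-cancelˡ-≡ (size c) (size c′) w (suc-injective (cong head0 eq))
    where
    head0 : List ℕ → ℕ
    head0 [] = 0
    head0 (x ∷ _) = x
  size-cons≡ : size (j ∷ c) ≡ size (j′ ∷ c′)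
  size-cons≡ = *-cancelˡ-≡ _ _ w (trans (sym (length-layered w (j ∷ c))) (trans (cong length eq) (length-layered w (j′ ∷ c′))))
  j≡j′ : j ≡ j′
  j≡j′ = suc-injective (+-cancelʳ-≡ (size c) (suc j) (suc j′) (trans size-cons≡ (cong (_+_ (suc j′)) (sym size≡))))
  c≡c′ : layered w c ≡ layered w c′
  c≡c′ = ++-cancelˡ (run (suc (w * size c)) (w * suc j)) _ _
           (trans eq (cong₂ (λ s k → run (suc (w * s)) (w * suc k) ++ layered w c′) (sym size≡) (sym j≡j′)))
layered-injective v {[]} {j′ ∷ c′} ()
layered-injective v {j ∷ c} {[]} ()

layer-end : ∀ v j c → suc (v * size c) + v * suc j ≡ suc (v * size (j ∷ c))
layer-end v j c = cong suc (trans (+-comm (v * size c) (v * suc j)) (sym (*-distribˡ-+ v (suc j) (size c))))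

layered-bounded : ∀ v c {x} → x ∈ layered v c → 0 < x × x ≤ v * size c
layered-bounded v (j ∷ c) {x} x∈ with ∈-++⁻ (run (suc (v * size c)) (v * suc j)) x∈
... | inj₁ x∈run = let (v*|c|<x , x<) = ∈-run⁻ (suc (v * size c)) (v * suc j) x∈run in
  <-≤-trans z<s v*|c|<x , ≤-pred (subst (x <_) (layer-end v j c) x<)
... | inj₂ x∈rest = let (0<x , x≤) = layered-bounded v c x∈rest in
  0<x , ≤-trans x≤ (*-monoʳ-≤ v (m≤n+m (size c) (suc j)))

layered-IsPermOf : ∀ v c → IsPermOf (v * size c) (layered v c)
layered-IsPermOf v [] = [] , (λ ()) , λ 0<x x≤0 → ⊥-elim (<-irrefl refl (<-≤-trans 0<x (≤-trans x≤0 (≤-reflexive (*-zeroʳ v)))))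
layered-IsPermOf v (j ∷ c) = Unique.++⁺ (run-unique A L) rest! disjoint , layered-bounded v (j ∷ c) , complete
  where
  A = suc (v * size c)
  L = v * suc j
  rest! : Unique (layered v c)
  rest! = proj₁ (layered-IsPermOf v c)
  disjoint : ∀ {x} → x ∈ run A L × x ∈ layered v c → ⊥
  disjoint (x∈run , x∈rest) = n≮n _ (<-≤-trans (s≤s (proj₂ (layered-bounded v c x∈rest))) (proj₁ (∈-run⁻ A L x∈run)))
  complete : ∀ {x} → 0 < x → x ≤ v * size (j ∷ c) → x ∈ run A L ++ layered v c
  complete {x} 0<x x≤ with x ≤? v * size c
  ... | yes x≤rest = ∈-++⁺ʳ (run A L) (proj₂ (proj₂ (layered-IsPermOf v c)) 0<x x≤rest)
  ... | no x≰rest = ∈-++⁺ˡ (∈-run⁺ A L (≰⇒> x≰rest) (subst (x <_) (sym (layer-end v j c)) (s≤s x≤)))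

Subseq-run-< : ∀ {x y t} a l → Subseq (x ∷ y ∷ t) (run a l) → x < y
Subseq-run-< a (suc l) (keep sub) = proj₁ (∈-run⁻ (suc a) l (Subseq-head-∈ sub))
Subseq-run-< a (suc l) (skip sub) = Subseq-run-< (suc a) l sub

-- Three entries split between a run and smaller values form a 123, 231, 312 or 321.
run++smaller-avoids : ∀ a l σ → (∀ {x} → x ∈ σ → x < a) → Avoids132∧213 σ → Avoids132∧213 (run a l ++ σ)
run++smaller-avoids a l σ σ<a σ-avoids x y z sub with Subseq-++⁻ (run a l) sub
... | [] , _ , refl , _ , sub₂ = σ-avoids x y z sub₂
... | x ∷ [] , y ∷ z ∷ [] , refl , sub₁ , sub₂ =
  (λ (x<y , _ , _) → <-asym x<y y<x) , (λ (_ , x<z , _) → <-asym x<z z<x)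
  where
  a≤x : a ≤ x
  a≤x = proj₁ (∈-run⁻ a l (Subseq-head-∈ sub₁))
  y<x : y < x
  y<x = <-≤-trans (σ<a (Subseq-head-∈ sub₂)) a≤x
  z<x : z < x
  z<x = <-≤-trans (σ<a (Subseq-head-∈ (Subseq-tail sub₂))) a≤x
... | x ∷ y ∷ [] , z ∷ [] , refl , sub₁ , sub₂ =
  (λ (_ , x<z , _) → <-asym x<z z<x) , (λ (y<x , _ , _) → <-asym x<y y<x)
  where
  x<y : x < y
  x<y = Subseq-run-< a l sub₁
  z<x : z < x
  z<x = <-≤-trans (σ<a (Subseq-head-∈ sub₂)) (proj₁ (∈-run⁻ a l (Subseq-head-∈ sub₁)))
... | x ∷ y ∷ z ∷ [] , [] , refl , sub₁ , _ =
  (λ (_ , _ , z<y) → <-asym y<z z<y) , (λ (y<x , _ , _) → <-asym x<y y<x)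
  where
  x<y : x < y
  x<y = Subseq-run-< a l sub₁
  y<z : y < z
  y<z = Subseq-run-< a l (Subseq-tail sub₁)

layered-avoids : ∀ v c → Avoids132∧213 (layered v c)
layered-avoids v [] x y z ()
layered-avoids v (j ∷ c) = run++smaller-avoids (suc (v * size c)) (v * suc j) (layered v c)
  (λ x∈ → s≤s (proj₂ (layered-bounded v c x∈))) (layered-avoids v c)

layered-DiamondBlocks : ∀ v c → DiamondBlocks v (size c) (layered v c)
layered-DiamondBlocks v [] i ()
layered-DiamondBlocks v (j ∷ c) = DiamondBlocks-run++⁺ v (layered-DiamondBlocks v c) (suc j) _

des-run++ : ∀ a l σ → des (run a (suc l) ++ σ) ≡ des (a + l ∷ σ)
des-run++ a zero σ = cong (λ b → des (b ∷ σ)) (sym (+-identityʳ a))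
des-run++ a (suc l) σ rewrite <ᵇ-false (<⇒≯ (n<1+n a)) =
  trans (des-run++ (suc a) l σ) (cong (λ b → des (b ∷ σ)) (sym (+-suc a l)))

des-larger-∷ : ∀ b w σ → (∀ {x} → x ∈ w ∷ σ → x < b) → des (b ∷ w ∷ σ) ≡ suc (des (w ∷ σ))
des-larger-∷ b w σ <b rewrite <ᵇ-true (<b (here refl)) = refl

des-layered : ∀ v c → des (layered (suc v) c) ≡ length c ∸ 1
des-layered v [] = refl
des-layered v (j ∷ []) = des-run++ (suc (suc v * 0)) (j + v * suc j) []
des-layered v (j ∷ c@(_ ∷ _)) = begin
  des (run A (suc l) ++ layered (suc v) c)   ≡⟨ des-run++ A l (layered (suc v) c) ⟩
  des (A + l ∷ layered (suc v) c)            ≡⟨ des-larger-∷ (A + l) _ _ (λ x∈ → ≤-trans (<A x∈) (m≤m+n A l)) ⟩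
  suc (des (layered (suc v) c))              ≡⟨ cong suc (des-layered v c) ⟩
  length c                                   ∎
  where
  open ≡-Reasoning
  A = suc (suc v * size c)
  l = j + v * suc j
  <A : ∀ {x} → x ∈ layered (suc v) c → x < A
  <A x∈ = s≤s (proj₂ (layered-bounded (suc v) c x∈))

record FirstLayer (v D : ℕ) (π : List ℕ) : Set where
  field
    j E : ℕ
    j+E≡D : suc j + E ≡ D
    σ : List ℕ
    π≡ : π ≡ run (suc (v * E)) (v * suc j) ++ σ
    σ-perm : IsPermOf (v * E) σ
    σ-avoids : Avoids132∧213 σ
    σ-blocks : DiamondBlocks v E σ

first-layer : ∀ v → 3 ≤ v → ∀ D a rest → IsPermOf (v * suc D) (a ∷ rest) → Avoids132∧213 (a ∷ rest) →
  DiamondBlocks v (suc D) (a ∷ rest) → FirstLayer v (suc D) (a ∷ rest)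
first-layer v 3≤v D a rest perm avoids blocks with run-decomposition (v * suc D) a rest perm avoids
... | record { a′ = a′ ; r = r ; a≡ = refl ; a′+r≡m = a′+r≡m ; 0<r = 0<r ; σ = σ ; π≡ = π≡
             ; σ-perm = σ-perm ; σ-avoids = σ-avoids ; σ<a = σ<a }
  with run-length-multiple v 3≤v (suc D) (suc a′) r σ 0<r (subst (DiamondBlocks v (suc D)) π≡ blocks) σ<a
         (trans (cong (_+_ r) (length-IsPermOf a′ σ-perm)) (trans (+-comm r a′) a′+r≡m))
... | j , refl = record
  { j = j ; E = E ; j+E≡D = j+E≡D ; σ = σ
  ; π≡ = trans π≡ (cong (λ b → run (suc b) (v * suc j) ++ σ) a′≡)
  ; σ-perm = subst (λ m → IsPermOf m σ) a′≡ σ-perm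
  ; σ-avoids = σ-avoids
  ; σ-blocks = DiamondBlocks-run++⁻ v (suc j) (suc a′)
      (subst (λ D′ → DiamondBlocks v D′ (run (suc a′) (v * suc j) ++ σ)) (sym j+E≡D)
        (subst (DiamondBlocks v (suc D)) π≡ blocks)) }
  where
  j≤D : suc j ≤ suc D
  j≤D = *-cancelˡ-≤ v {{>-nonZero (≤-trans (s≤s z≤n) 3≤v)}} (≤-trans (m≤n+m (v * suc j) a′) (≤-reflexive a′+r≡m))
  E = suc D ∸ suc j
  j+E≡D : suc j + E ≡ suc D
  j+E≡D = m+[n∸m]≡n j≤D
  a′≡ : a′ ≡ v * E
  a′≡ = +-cancelʳ-≡ (v * suc j) a′ (v * E) (begin
    a′ + v * suc j          ≡⟨ a′+r≡m ⟩
    v * suc D               ≡⟨ cong (v *_) j+E≡D ⟨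
    v * (suc j + E)         ≡⟨ *-distribˡ-+ v (suc j) E ⟩
    v * suc j + v * E       ≡⟨ +-comm (v * suc j) (v * E) ⟩
    v * E + v * suc j       ∎)
    where open ≡-Reasoning

layered-complete : ∀ v → 3 ≤ v → ∀ D π → IsPermOf (v * D) π → Avoids132∧213 π → DiamondBlocks v D π →
  ∃ λ c → size c ≡ D × π ≡ layered v c
layered-complete v 3≤v D π = go D (<-wellFounded D) π
  where
  go : ∀ D → Acc _<_ D → ∀ π → IsPermOf (v * D) π → Avoids132∧213 π → DiamondBlocks v D π →
    ∃ λ c → size c ≡ D × π ≡ layered v c
  go zero _ [] _ _ _ = [] , refl , refl
  go zero _ (a ∷ _) (_ , bounded , _) _ _ =
    ⊥-elim (<-irrefl refl (<-≤-trans (proj₁ (bounded (here refl))) (≤-trans (proj₂ (bounded (here refl))) (≤-reflexive (*-zeroʳ v)))))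
  go (suc D) _ [] (_ , _ , complete) _ _ with () ← complete {1} z<s (≤-trans (≤-trans (s≤s z≤n) 3≤v) (m≤m*n v (suc D)))
  go (suc D) (acc smaller) (a ∷ rest) perm avoids blocks with first-layer v 3≤v D a rest perm avoids blocks
  ... | record { j = j ; E = E ; j+E≡D = refl ; σ = σ ; π≡ = π≡ ; σ-perm = σ-perm ; σ-avoids = σ-avoids ; σ-blocks = σ-blocks }
    with go E (smaller (s≤s (m≤n+m E j))) σ σ-perm σ-avoids σ-blocks
  ... | c , refl , refl = j ∷ c , refl , π≡

isCounted : ℕ → List ℕ → Bool
isCounted k π = avoidsAll (p132 ∷ p213 ∷ []) π ∧ (des π ≡ᵇ k)

∈-countedWords⇒layered : ∀ v → 3 ≤ v → ∀ d k {π} → π ∈ filterᵇ (isCounted k) (diamondWords v (suc d)) →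
  π ∈ map (layered v) (compositions (suc d) k)
∈-countedWords⇒layered v@(suc v′) 3≤v d k {π} π∈
  with ∈-filter⁻ (T? ∘ isCounted k) π∈
... | π∈words , counted with ∈-filter⁻ (T? ∘ isDiamondWord v (suc d)) π∈words | Equivalence.to T-∧ counted
... | π∈perms , diamond | avoids , des≡k
  with layered-complete v 3≤v (suc d) π (∈-perms-oneTo⇒IsPermOf (v * suc d) π∈perms)
         (avoids⇒Avoids132∧213 π avoids) (isDiamondWord⇒DiamondBlocks v (suc d) π diamond)
... | j ∷ c , size≡ , refl = ∈-map⁺ (layered v)
  (∈-compositions⁺ (suc d) k (j ∷ c) size≡ (cong suc (trans (sym (des-layered v′ (j ∷ c))) (≡ᵇ⇒≡ _ _ des≡k))))

layered∈diamondWords : ∀ v c → layered v c ∈ diamondWords v (size c)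
layered∈diamondWords v c =
  ∈-filter⁺ (T? ∘ isDiamondWord v (size c))
    (IsPermOf⇒∈-perms-oneTo _ (layered-IsPermOf v c))
    (DiamondBlocks⇒isDiamondWord v (size c) _ (layered-DiamondBlocks v c))

layered⇒∈-countedWords : ∀ v d k {c} → c ∈ compositions (suc d) k →
  layered (suc v) c ∈ filterᵇ (isCounted k) (diamondWords (suc v) (suc d))
layered⇒∈-countedWords v d k {c} c∈ with ∈-compositions⁻ (suc d) k c∈
... | size≡ , length≡ =
  ∈-filter⁺ (T? ∘ isCounted k)
    (subst (λ n → layered (suc v) c ∈ diamondWords (suc v) n) size≡ (layered∈diamondWords (suc v) c))
    (Equivalence.from T-∧ (Avoids132∧213⇒avoids _ (layered-avoids (suc v) c) ,
                           ≡⇒≡ᵇ _ _ (trans (des-layered v c) (cong (_∸ 1) length≡))))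

count≡compositions : ∀ v → 3 ≤ v → ∀ d k → count v (suc d) k ≡ length (compositions (suc d) k)
count≡compositions v@(suc v′) 3≤v d k =
  trans (unique∧set⇒length≡ counted! layered! (mk⇔ (∈-countedWords⇒layered v 3≤v d k) from))
        (length-map (layered v) (compositions (suc d) k))
  where
  counted! : Unique (filterᵇ (isCounted k) (diamondWords v (suc d)))
  counted! = Unique.filter⁺ _ (Unique.filter⁺ _ (perms-unique (oneTo (v * suc d)) (oneTo-unique (v * suc d))))
  layered! : Unique (map (layered v) (compositions (suc d) k))
  layered! = Unique.map⁺ (layered-injective v′) (compositions-unique (suc d) k)
  from : ∀ {π} → π ∈ map (layered v) (compositions (suc d) k) → π ∈ filterᵇ (isCounted k) (diamondWords v (suc d))
  from π∈ with ∈-map⁻ (layered v) π∈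
  ... | c , c∈ , refl = layered⇒∈-countedWords v′ d k c∈

-- The power series identity

Σ< : ℕ → (ℕ → ℤ) → ℤ
Σ< n f = foldr ℤ._+_ (+ 0) (applyUpTo f n)

sumTo≡Σ< : ∀ n f → sumTo n f ≡ Σ< (suc n) f
sumTo≡Σ< n f = cong (foldr ℤ._+_ (+ 0)) (map-upTo f (suc n))

sumTo-cong : ∀ n {f g : ℕ → ℤ} → (∀ i → f i ≡ g i) → sumTo n f ≡ sumTo n g
sumTo-cong n f≗g = cong (foldr ℤ._+_ (+ 0)) (map-cong f≗g (upTo (suc n)))

Σ<-zero : ∀ n f → (∀ i → f i ≡ + 0) → Σ< n f ≡ + 0
Σ<-zero zero f f≗0 = refl
Σ<-zero (suc n) f f≗0 = cong₂ ℤ._+_ (f≗0 0) (Σ<-zero n (λ i → f (suc i)) (λ i → f≗0 (suc i)))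

Σ<-last : ∀ m f → (∀ i → i < m → f i ≡ + 0) → Σ< (suc m) f ≡ f m
Σ<-last zero f _ = ℤ.+-identityʳ (f 0)
Σ<-last (suc m) f f<m≡0 =
  trans (cong₂ ℤ._+_ (f<m≡0 0 (s≤s z≤n)) (Σ<-last m (λ i → f (suc i)) (λ i i<m → f<m≡0 (suc i) (s≤s i<m))))
        (ℤ.+-identityˡ (f (suc m)))

Σ<-lastTwo : ∀ m f → (∀ i → i < m → f i ≡ + 0) → Σ< (suc (suc m)) f ≡ f m ℤ.+ f (suc m)
Σ<-lastTwo zero f _ = cong (λ t → f 0 ℤ.+ t) (ℤ.+-identityʳ (f 1))
Σ<-lastTwo (suc m) f f<m≡0 =
  trans (cong₂ ℤ._+_ (f<m≡0 0 (s≤s z≤n)) (Σ<-lastTwo m (λ i → f (suc i)) (λ i i<m → f<m≡0 (suc i) (s≤s i<m))))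
        (ℤ.+-identityˡ (f (suc m) ℤ.+ f (suc (suc m))))

mulOnePlusX : (ℕ → ℤ) → ℕ → ℤ
mulOnePlusX f zero = f 0
mulOnePlusX f (suc k) = f k ℤ.+ f (suc k)

*-neg1 : ∀ i → i ℤ.* - (+ 1) ≡ - i
*-neg1 i = trans (sym (ℤ.neg-distribʳ-* i (+ 1))) (cong -_ (ℤ.*-identityʳ i))

denom-row0 : ∀ {j k} → j < k → denom 0 (k ∸ j) ≡ + 0
denom-row0 {j} {k} j<k with k ∸ j | m<n⇒0<n∸m j<k
... | suc _ | _ = refl

denom-row1 : ∀ {j k} → j < k → denom 1 (suc k ∸ j) ≡ + 0
denom-row1 {zero} {suc k} _ = refl
denom-row1 {suc j} {suc k} (s≤s j<k) = denom-row1 j<k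

convolveRow : ℕ → (ℕ → ℤ) → ℕ → ℤ
convolveRow a f k = sumTo k (λ j → f j ℤ.* denom a (k ∸ j))

convolveRow0 : ∀ f k → convolveRow 0 f k ≡ f k
convolveRow0 f k = begin
  sumTo k g            ≡⟨ sumTo≡Σ< k g ⟩
  Σ< (suc k) g         ≡⟨ Σ<-last k g (λ j j<k → trans (cong (f j ℤ.*_) (denom-row0 j<k)) (ℤ.*-zeroʳ (f j))) ⟩
  f k ℤ.* denom 0 (k ∸ k) ≡⟨ cong (λ n → f k ℤ.* denom 0 n) (n∸n≡0 k) ⟩
  f k ℤ.* + 1            ≡⟨ ℤ.*-identityʳ (f k) ⟩
  f k                  ∎
  where
  open ≡-Reasoning
  g = λ j → f j ℤ.* denom 0 (k ∸ j)

convolveRow1 : ∀ f k → convolveRow 1 f k ≡ - mulOnePlusX f k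
convolveRow1 f zero = trans (ℤ.+-identityʳ _) (*-neg1 (f 0))
convolveRow1 f (suc k) = begin
  sumTo (suc k) g                                  ≡⟨ sumTo≡Σ< (suc k) g ⟩
  Σ< (suc (suc k)) g                               ≡⟨ Σ<-lastTwo k g (λ j j<k → trans (cong (f j ℤ.*_) (denom-row1 j<k)) (ℤ.*-zeroʳ (f j))) ⟩
  f k ℤ.* denom 1 (suc k ∸ k) ℤ.+ f (suc k) ℤ.* denom 1 (k ∸ k)
    ≡⟨ cong₂ (λ m n → f k ℤ.* denom 1 m ℤ.+ f (suc k) ℤ.* denom 1 n) (m+n∸n≡m 1 k) (n∸n≡0 k) ⟩
  f k ℤ.* - (+ 1) ℤ.+ f (suc k) ℤ.* - (+ 1)              ≡⟨ cong₂ ℤ._+_ (*-neg1 (f k)) (*-neg1 (f (suc k))) ⟩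
  - f k ℤ.+ - f (suc k)                              ≡⟨ ℤ.neg-distrib-+ (f k) (f (suc k)) ⟨
  - (f k ℤ.+ f (suc k))                              ∎
  where
  open ≡-Reasoning
  g = λ j → f j ℤ.* denom 1 (suc k ∸ j)

convolveRow≥2 : ∀ a f k → convolveRow (suc (suc a)) f k ≡ + 0
convolveRow≥2 a f k = trans (sumTo≡Σ< k g) (Σ<-zero (suc k) g (λ j → ℤ.*-zeroʳ (f j)))
  where g = λ j → f j ℤ.* denom (suc (suc a)) (k ∸ j)

convolveRow-far : ∀ {i d} f k → i < d → convolveRow (suc d ∸ i) f k ≡ + 0
convolveRow-far {zero} {suc d} f k _ = convolveRow≥2 d f k
convolveRow-far {suc i} {suc d} f k (s≤s i<d) = convolveRow-far f k i<d

⊛-denom-zero : ∀ L k → (L ⊛ denom) 0 k ≡ L 0 k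
⊛-denom-zero L k = trans (ℤ.+-identityʳ _) (convolveRow0 (L 0) k)

⊛-denom-suc : ∀ L d k → (L ⊛ denom) (suc d) k ≡ L (suc d) k ℤ.- mulOnePlusX (L d) k
⊛-denom-suc L d k = begin
  sumTo (suc d) F                   ≡⟨ sumTo≡Σ< (suc d) F ⟩
  Σ< (suc (suc d)) F                ≡⟨ Σ<-lastTwo d F (λ i i<d → convolveRow-far (L i) k i<d) ⟩
  F d ℤ.+ F (suc d)                   ≡⟨ cong₂ ℤ._+_ (cong (λ a → convolveRow a (L d) k) (m+n∸n≡m 1 d))
                                                 (cong (λ a → convolveRow a (L (suc d)) k) (n∸n≡0 d)) ⟩
  convolveRow 1 (L d) k ℤ.+ convolveRow 0 (L (suc d)) k
                                    ≡⟨ cong₂ ℤ._+_ (convolveRow1 (L d) k) (convolveRow0 (L (suc d)) k) ⟩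
  - mulOnePlusX (L d) k ℤ.+ L (suc d) k ≡⟨ ℤ.+-comm (- mulOnePlusX (L d) k) (L (suc d) k) ⟩
  L (suc d) k ℤ.- mulOnePlusX (L d) k ∎
  where
  open ≡-Reasoning
  F = λ i → convolveRow (suc d ∸ i) (L i) k

⊛-congˡ : ∀ {L M : Series} (S : Series) → (∀ d k → L d k ≡ M d k) → ∀ d k → (L ⊛ S) d k ≡ (M ⊛ S) d k
⊛-congˡ S L≗M d k = sumTo-cong d (λ i → sumTo-cong k (λ j → cong (ℤ._* S (d ∸ i) (k ∸ j)) (L≗M i j)))

compositionSeries : Series
compositionSeries zero zero = + 1
compositionSeries zero (suc k) = + 0
compositionSeries (suc n) k = + length (compositions (suc n) k)

compositionSeries-pascal : ∀ n k → compositionSeries (suc (suc n)) k ≡ mulOnePlusX (compositionSeries (suc n)) k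
compositionSeries-pascal n zero = refl
compositionSeries-pascal n (suc k) =
  trans (cong +_ (length-compositions-suc n k))
        (ℤ.pos-+ (length (compositions (suc n) k)) (length (compositions (suc n) (suc k))))

compositionSeries⊛denom : ∀ d k → (compositionSeries ⊛ denom) d k ≡ numer d k
compositionSeries⊛denom zero k = trans (⊛-denom-zero compositionSeries k) (y⁰-coefficient k)
  where
  y⁰-coefficient : ∀ k → compositionSeries 0 k ≡ numer 0 k
  y⁰-coefficient zero = refl
  y⁰-coefficient (suc k) = refl
compositionSeries⊛denom (suc zero) k = trans (⊛-denom-suc compositionSeries 0 k) (y¹-coefficient k)
  where
  y¹-coefficient : ∀ k → compositionSeries 1 k ℤ.- mulOnePlusX (compositionSeries 0) k ≡ numer 1 k
  y¹-coefficient zero = refl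
  y¹-coefficient (suc zero) = refl
  y¹-coefficient (suc (suc k)) = refl
compositionSeries⊛denom (suc (suc n)) k = begin
  (compositionSeries ⊛ denom) (suc (suc n)) k
    ≡⟨ ⊛-denom-suc compositionSeries (suc n) k ⟩
  compositionSeries (suc (suc n)) k ℤ.- mulOnePlusX (compositionSeries (suc n)) k
    ≡⟨ cong (ℤ._- mulOnePlusX (compositionSeries (suc n)) k) (compositionSeries-pascal n k) ⟩
  mulOnePlusX (compositionSeries (suc n)) k ℤ.- mulOnePlusX (compositionSeries (suc n)) k
    ≡⟨ ℤ.+-inverseʳ (mulOnePlusX (compositionSeries (suc n)) k) ⟩
  + 0 ∎
  where open ≡-Reasoning

lhsSeries≡compositionSeries : ∀ v → 3 ≤ v → ∀ d k → lhsSeries v d k ≡ compositionSeries d k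
lhsSeries≡compositionSeries v 3≤v zero zero = refl
lhsSeries≡compositionSeries v 3≤v zero (suc k) = refl
lhsSeries≡compositionSeries v 3≤v (suc d) k = cong +_ (count≡compositions v 3≤v d k)

theorem3p2 : (v : ℕ) → 4 ≤ v → (d k : ℕ) → (lhsSeries v ⊛ denom) d k ≡ numer d k
theorem3p2 v 4≤v d k =
  trans (⊛-congˡ denom (lhsSeries≡compositionSeries v (≤-trans (n≤1+n 3) 4≤v)) d k)
        (compositionSeries⊛denom d k)
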